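{- For every finite poset $(\mathfrak{Q},\sqsubseteq)$ the following are equivalent: (1) the Hasse diagram $\mathscr{H}(\mathfrak{Q},\sqsubseteq)$ has the global pairwise-lca-property; (2) $\mathscr{H}(\mathfrak{Q},\sqsubseteq)$ has the global lca-property; (3) $(\mathfrak{Q},\sqsubseteq)$ is a join-semilattice.
   Context: The Hasse diagram $\mathscr{H}(\mathfrak{Q},\sqsubseteq)$ is the DAG with vertex set $\mathfrak{Q}$ and an edge from $A$ to $B$ iff $B\sqsubseteq A$, $A\ne B$, and there is no $C\in\mathfrak{Q}$ with $B\sqsubseteq C\sqsubseteq A$ and $C\ne A,B$. For a DAG $G$, $u\preceq_G v$ means there is a directed path from $v$ to $u$ (including $u=v$); for non-empty $A\subseteq V(G)$, $\mathrm{LCA}_G(A)$ is the set of $\preceq_G$-minimal vertices $v$ with $a\preceq_G v$ for all $a\in A$. $G$ has the global lca-property if $|\mathrm{LCA}_G(A)|=1$ for all non-empty $A\subseteq V(G)$, and the global pairwise-lca-property if this holds for all $A\subseteq V(G)$ with $|A|=2$. A join-semilattice is a poset in which any two elements have a least upper bound. -}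

module Defs where

open import Level using (Level; _⊔_)
open import Data.Nat using (ℕ)
open import Data.Fin using (Fin)
open import Data.Fin.Subset using (Subset; _∈_; ∣_∣; Nonempty)
open import Data.Product using (Σ; ∃; _×_)
open import Relation.Nullary using (¬_)
open import Relation.Binary.PropositionalEquality using (_≡_; _≢_)
open import Relation.Binary.Construct.Closure.ReflexiveTransitive using (Star)

-- A finite poset is represented (up to isomorphism) by a partial order _⊑_ on
-- Fin n (with propositional equality as the underlying equality).

module _ {n : ℕ} {ℓ : Level} (_⊑_ : Fin n → Fin n → Set ℓ) where

  HasseEdge : Fin n → Fin n → Set ℓ
  HasseEdge A B = (B ⊑ A) × (A ≢ B) ×
    (¬ (Σ (Fin n) λ C → (B ⊑ C) × (C ⊑ A) × (C ≢ A) × (C ≢ B)))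

  _⪯H_ : Fin n → Fin n → Set ℓ
  u ⪯H v = Star HasseEdge v u

  IsCommonAncestor : Subset n → Fin n → Set ℓ
  IsCommonAncestor A v = ∀ a → a ∈ A → a ⪯H v

  IsLCA : Subset n → Fin n → Set ℓ
  IsLCA A v = IsCommonAncestor A v ×
    (∀ w → IsCommonAncestor A w → w ⪯H v → w ≡ v)

  UniqueLCA : Subset n → Set ℓ
  UniqueLCA A = Σ (Fin n) λ v → IsLCA A v × (∀ w → IsLCA A w → w ≡ v)

  GlobalLcaProperty : Set ℓ
  GlobalLcaProperty = ∀ (A : Subset n) → Nonempty A → UniqueLCA A

  GlobalPairwiseLcaProperty : Set ℓ
  GlobalPairwiseLcaProperty = ∀ (A : Subset n) → ∣ A ∣ ≡ 2 → UniqueLCA A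

  IsLeastUpperBound : Fin n → Fin n → Fin n → Set ℓ
  IsLeastUpperBound x y z = (x ⊑ z) × (y ⊑ z) × (∀ w → x ⊑ w → y ⊑ w → z ⊑ w)

  IsJoinSemilattice : Set ℓ
  IsJoinSemilattice = ∀ x y → Σ (Fin n) λ z → IsLeastUpperBound x y z

{-# OPTIONS --safe #-}
-- Every edge of the Hasse diagram goes down in the order, and conversely, since
-- a finite partial order is well-founded, every x ⊑ y is realised by a path of
-- covering edges as soon as ⊑ is decidable. Common ancestors in the diagram are
-- then exactly the upper bounds, an lca is a minimal upper bound, and a set has a
-- unique lca iff it has a supremum. Decidability of ⊑ comes for free from joins,
-- and from the pairwise-lca property it follows by a double-negation argument.
module Submission where

open import Defs
open import Level using (Level)
open import Data.Nat using (ℕ; suc)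
open import Data.Fin using (Fin; zero; suc; _≟_)
open import Data.Fin.Properties using (any?; all?; sequence)
open import Data.Fin.Subset using (Subset; _∈_; ∣_∣; Nonempty; ⁅_⁆; _∪_; inside; outside)
open import Data.Fin.Subset.Properties
  using (_∈?_; x∈⁅x⁆; x∈⁅y⁆⇒x≡y; x∈p∪q⁻; p⊆p∪q; q⊆p∪q; ∣⁅x⁆∣≡1; ∪-identityˡ; ∪-identityʳ)
open import Data.List using (List; []; _∷_; foldr; filter; allFin)
open import Data.List.Relation.Unary.All as All using (All; []; _∷_)
open import Data.List.Relation.Unary.All.Properties using (all-filter)
open import Data.List.Relation.Unary.Any using (here; there)
import Data.List.Membership.Propositional as List
open import Data.List.Membership.Propositional.Properties using (∈-filter⁺; ∈-allFin)
open import Data.Product using (∃; _×_; _,_; proj₁; proj₂)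
open import Data.Sum using (_⊎_; inj₁; inj₂)
open import Data.Vec using (_∷_; here; there)
open import Effect.Monad using (RawMonad)
open import Function using (_∘_; flip)
open import Function.Bundles using (_⇔_; mk⇔)
open import Induction.WellFounded using (Acc; acc)
open import Data.Fin.Induction using (po-wellFounded; po-noetherian)
open import Relation.Binary using (Decidable; IsPartialOrder)
import Relation.Binary.Construct.NonStrictToStrict as ToStrict
open import Relation.Binary.Construct.Closure.ReflexiveTransitive using (ε; _◅_; _◅◅_)
open import Relation.Binary.PropositionalEquality using (_≡_; _≢_; refl; sym; trans; cong; subst; ≢-sym)
open import Relation.Nullary using (¬_; yes; no; ¬?; contradiction)
open import Relation.Nullary.Decidable using (_×-dec_; _→-dec_; ¬¬-excluded-middle; decidable-stable)
open import Relation.Nullary.Negation using (¬¬-Monad)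
open import Relation.Unary using (Pred)
import Relation.Unary as U

∣p∣≡1+k⇒Nonempty : ∀ {m k} (p : Subset m) → ∣ p ∣ ≡ suc k → Nonempty p
∣p∣≡1+k⇒Nonempty (inside ∷ p) _ = zero , here
∣p∣≡1+k⇒Nonempty (outside ∷ p) e with ∣p∣≡1+k⇒Nonempty p e
... | i , i∈p = suc i , there i∈p

pair : ∀ {m} → Fin m → Fin m → Subset m
pair x y = ⁅ x ⁆ ∪ ⁅ y ⁆

x∈pair : ∀ {m} (x y : Fin m) → x ∈ pair x y
x∈pair x y = p⊆p∪q ⁅ y ⁆ (x∈⁅x⁆ x)

y∈pair : ∀ {m} (x y : Fin m) → y ∈ pair x y
y∈pair x y = q⊆p∪q ⁅ x ⁆ ⁅ y ⁆ (x∈⁅x⁆ y)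

∈pair⇒≡x⊎≡y : ∀ {m} {x y z : Fin m} → z ∈ pair x y → z ≡ x ⊎ z ≡ y
∈pair⇒≡x⊎≡y {x = x} {y} z∈ with x∈p∪q⁻ ⁅ x ⁆ ⁅ y ⁆ z∈
... | inj₁ z∈⁅x⁆ = inj₁ (x∈⁅y⁆⇒x≡y x z∈⁅x⁆)
... | inj₂ z∈⁅y⁆ = inj₂ (x∈⁅y⁆⇒x≡y y z∈⁅y⁆)

∣pair∣≡2 : ∀ {m} {x y : Fin m} → x ≢ y → ∣ pair x y ∣ ≡ 2
∣pair∣≡2 {x = zero}  {zero}  x≢y = contradiction refl x≢y
∣pair∣≡2 {x = zero}  {suc y} _   = cong suc (trans (cong ∣_∣ (∪-identityˡ ⁅ y ⁆)) (∣⁅x⁆∣≡1 y))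
∣pair∣≡2 {x = suc x} {zero}  _   = cong suc (trans (cong ∣_∣ (∪-identityʳ ⁅ x ⁆)) (∣⁅x⁆∣≡1 x))
∣pair∣≡2 {x = suc x} {suc y} x≢y = ∣pair∣≡2 (x≢y ∘ cong suc)

¬¬-decidable : ∀ {n ℓ} (_∼_ : Fin n → Fin n → Set ℓ) → ¬ ¬ Decidable _∼_
¬¬-decidable _∼_ = ¬¬-∀ λ _ → ¬¬-∀ λ _ → ¬¬-excluded-middle
  where
  ¬¬-∀ : ∀ {m p} {P : Fin m → Set p} → (∀ i → ¬ ¬ P i) → ¬ ¬ (∀ i → P i)
  ¬¬-∀ = sequence (RawMonad.rawApplicative ¬¬-Monad)

module FinitePoset {ℓ : Level} {n : ℕ} {_⊑_ : Fin n → Fin n → Set ℓ}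
                   (isPO : IsPartialOrder _≡_ _⊑_) where

  open IsPartialOrder isPO using (antisym) renaming (refl to ⊑-refl; trans to ⊑-trans)

  _⊏_ : Fin n → Fin n → Set ℓ
  _⊏_ = ToStrict._<_ _≡_ _⊑_

  _⪯_ : Fin n → Fin n → Set ℓ
  _⪯_ = _⪯H_ _⊑_

  IsUpperBound : Subset n → Fin n → Set ℓ
  IsUpperBound A v = ∀ a → a ∈ A → a ⊑ v

  IsSupremum : Subset n → Fin n → Set ℓ
  IsSupremum A s = IsUpperBound A s × (∀ w → IsUpperBound A w → s ⊑ w)

  ⪯⇒⊑ : ∀ {u v} → u ⪯ v → u ⊑ v
  ⪯⇒⊑ ε = ⊑-refl
  ⪯⇒⊑ (edge ◅ path) = ⊑-trans (⪯⇒⊑ path) (proj₁ edge)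

  ancestor⇒upperBound : ∀ {A v} → IsCommonAncestor _⊑_ A v → IsUpperBound A v
  ancestor⇒upperBound anc a a∈A = ⪯⇒⊑ (anc a a∈A)

  upperBound-pair : ∀ {x y w} → x ⊑ w → y ⊑ w → IsUpperBound (pair x y) w
  upperBound-pair x⊑w y⊑w a a∈ with ∈pair⇒≡x⊎≡y a∈
  ... | inj₁ refl = x⊑w
  ... | inj₂ refl = y⊑w

  IsSupremum⇒IsLeastUpperBound : ∀ {x y s} → IsSupremum (pair x y) s → IsLeastUpperBound _⊑_ x y s
  IsSupremum⇒IsLeastUpperBound {x} {y} (ub , least) =
    ub x (x∈pair x y) , ub y (y∈pair x y) , λ w x⊑w y⊑w → least w (upperBound-pair x⊑w y⊑w)

  module WithDecidableOrder (_⊑?_ : Decidable _⊑_) where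

    ∃-minimal-below : ∀ {p} {P : Pred (Fin n) p} → U.Decidable P → ∀ {c} → P c →
                      ∃ λ v → v ⊑ c × P v × (∀ {w} → P w → w ⊑ v → w ≡ v)
    ∃-minimal-below {P = P} P? = go (po-wellFounded isPO _)
      where
      go : ∀ {c} → Acc _⊏_ c → P c → ∃ λ v → v ⊑ c × P v × (∀ {w} → P w → w ⊑ v → w ≡ v)
      go {c} (acc below) Pc with any? (λ w → P? w ×-dec (w ⊑? c) ×-dec ¬? (w ≟ c))
      ... | yes (w , Pw , w⊑c , w≢c) =
        let v , v⊑w , Pv , minimal = go (below (w⊑c , w≢c)) Pw
        in v , ⊑-trans v⊑w w⊑c , Pv , minimal
      ... | no none = c , ⊑-refl , Pc ,
        λ {w} Pw w⊑c → decidable-stable (w ≟ c) λ w≢c → none (w , Pw , w⊑c , w≢c)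

    -- A minimal element strictly above x and below y covers x.
    ⊏⇒coveredBelow : ∀ {x y} → x ⊏ y → ∃ λ c → HasseEdge _⊑_ c x × c ⊑ y
    ⊏⇒coveredBelow {x} x⊏y with ∃-minimal-below (λ c → (x ⊑? c) ×-dec ¬? (x ≟ c)) x⊏y
    ... | c , c⊑y , (x⊑c , x≢c) , minimal =
      c , (x⊑c , ≢-sym x≢c , λ (d , x⊑d , d⊑c , d≢c , d≢x) → d≢c (minimal (x⊑d , ≢-sym d≢x) d⊑c)) , c⊑y

    ⊑⇒⪯ : ∀ {x y} → x ⊑ y → x ⪯ y
    ⊑⇒⪯ = go (po-noetherian isPO _)
      where
      go : ∀ {x y} → Acc (flip _⊏_) x → x ⊑ y → x ⪯ y
      go {x} {y} (acc above) x⊑y with x ≟ y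
      ... | yes refl = ε
      ... | no x≢y with ⊏⇒coveredBelow (x⊑y , x≢y)
      ... | c , x⋖c@(x⊑c , c≢x , _) , c⊑y = go (above (x⊑c , ≢-sym c≢x)) c⊑y ◅◅ (x⋖c ◅ ε)

    upperBound⇒ancestor : ∀ {A v} → IsUpperBound A v → IsCommonAncestor _⊑_ A v
    upperBound⇒ancestor ub a a∈A = ⊑⇒⪯ (ub a a∈A)

    upperBound? : ∀ A → U.Decidable (IsUpperBound A)
    upperBound? A v = all? λ a → (a ∈? A) →-dec (a ⊑? v)

    upperBound⇒∃LCA-below : ∀ {A w} → IsUpperBound A w → ∃ λ v → IsLCA _⊑_ A v × v ⊑ w
    upperBound⇒∃LCA-below {A} ub with ∃-minimal-below (upperBound? A) ub
    ... | v , v⊑w , ubv , minimal =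
      v , (upperBound⇒ancestor ubv , λ u anc u⪯v → minimal (ancestor⇒upperBound anc) (⪯⇒⊑ u⪯v)) , v⊑w

    IsSupremum⇒UniqueLCA : ∀ {A s} → IsSupremum A s → UniqueLCA _⊑_ A
    IsSupremum⇒UniqueLCA {A} {s} (ub , least) = s , (upperBound⇒ancestor ub , minimal) , unique
      where
      minimal : ∀ w → IsCommonAncestor _⊑_ A w → w ⪯ s → w ≡ s
      minimal w anc w⪯s = antisym (⪯⇒⊑ w⪯s) (least w (ancestor⇒upperBound anc))
      unique : ∀ w → IsLCA _⊑_ A w → w ≡ s
      unique w (anc , minimalʷ) =
        sym (minimalʷ s (upperBound⇒ancestor ub) (⊑⇒⪯ (least w (ancestor⇒upperBound anc))))

    UniqueLCA⇒IsSupremum : ∀ {A} → ((v , _) : UniqueLCA _⊑_ A) → IsSupremum A v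
    UniqueLCA⇒IsSupremum {A} (v , (anc , _) , unique) = ancestor⇒upperBound anc , least
      where
      least : ∀ w → IsUpperBound A w → v ⊑ w
      least w ub with upperBound⇒∃LCA-below ub
      ... | v′ , lca′ , v′⊑w = subst (_⊑ w) (unique v′ lca′) v′⊑w

  joinSemilattice⇒decidable : IsJoinSemilattice _⊑_ → Decidable _⊑_
  joinSemilattice⇒decidable join x y with join x y
  ... | z , x⊑z , y⊑z , least with z ≟ y
  ... | yes refl = yes x⊑z
  ... | no z≢y = no λ x⊑y → z≢y (antisym (least y x⊑y ⊑-refl) y⊑z)

  -- In the last case x ⊑ y would make y a common ancestor below v. Turning x ⊑ y
  -- into a path needs decidability of ⊑, available because the goal is a negation.
  pairwiseLca⇒decidable : GlobalPairwiseLcaProperty _⊑_ → Decidable _⊑_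
  pairwiseLca⇒decidable pairwise x y with x ≟ y
  ... | yes refl = yes ⊑-refl
  ... | no x≢y with pairwise (pair x y) (∣pair∣≡2 x≢y)
  ... | v , (anc , minimal) , _ with v ≟ y
  ... | yes refl = yes (⪯⇒⊑ (anc x (x∈pair x y)))
  ... | no v≢y = no λ x⊑y → ¬¬-decidable _⊑_ λ _⊑?_ →
    let open WithDecidableOrder _⊑?_
    in v≢y (sym (minimal y (upperBound⇒ancestor (upperBound-pair x⊑y ⊑-refl)) (anc y (y∈pair x y))))

  module Joins (join : IsJoinSemilattice _⊑_) where

    _∨_ : Fin n → Fin n → Fin n
    x ∨ y = proj₁ (join x y)

    x⊑x∨y : ∀ x y → x ⊑ (x ∨ y)
    x⊑x∨y x y = proj₁ (proj₂ (join x y))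

    y⊑x∨y : ∀ x y → y ⊑ (x ∨ y)
    y⊑x∨y x y = proj₁ (proj₂ (proj₂ (join x y)))

    ∨-least : ∀ {x y w} → x ⊑ w → y ⊑ w → (x ∨ y) ⊑ w
    ∨-least {x} {y} x⊑w y⊑w = proj₂ (proj₂ (proj₂ (join x y))) _ x⊑w y⊑w

    ⋁ : Fin n → List (Fin n) → Fin n
    ⋁ = foldr _∨_

    ⋁-upperBound : ∀ s {x xs} → x List.∈ xs → x ⊑ ⋁ s xs
    ⋁-upperBound s {xs = y ∷ xs} (here refl)  = x⊑x∨y y (⋁ s xs)
    ⋁-upperBound s {xs = y ∷ xs} (there x∈xs) = ⊑-trans (⋁-upperBound s x∈xs) (y⊑x∨y y (⋁ s xs))

    ⋁-least : ∀ {s w} xs → s ⊑ w → All (_⊑ w) xs → ⋁ s xs ⊑ w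
    ⋁-least []       s⊑w []           = s⊑w
    ⋁-least (x ∷ xs) s⊑w (x⊑w ∷ xs⊑w) = ∨-least x⊑w (⋁-least xs s⊑w xs⊑w)

    Nonempty⇒∃IsSupremum : ∀ {A} → Nonempty A → ∃ (IsSupremum A)
    Nonempty⇒∃IsSupremum {A} (a , a∈A) = ⋁ a elements , upperBound , least
      where
      elements : List (Fin n)
      elements = filter (_∈? A) (allFin n)
      upperBound : IsUpperBound A (⋁ a elements)
      upperBound b b∈A = ⋁-upperBound a (∈-filter⁺ (_∈? A) (∈-allFin b) b∈A)
      least : ∀ w → IsUpperBound A w → ⋁ a elements ⊑ w
      least w ub = ⋁-least elements (ub a a∈A) (All.map (ub _) (all-filter (_∈? A) (allFin n)))

  joinSemilattice⇒globalLca : IsJoinSemilattice _⊑_ → GlobalLcaProperty _⊑_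
  joinSemilattice⇒globalLca join A nonempty =
    IsSupremum⇒UniqueLCA (proj₂ (Nonempty⇒∃IsSupremum nonempty))
    where open Joins join
          open WithDecidableOrder (joinSemilattice⇒decidable join)

  globalLca⇒pairwiseLca : GlobalLcaProperty _⊑_ → GlobalPairwiseLcaProperty _⊑_
  globalLca⇒pairwiseLca global A ∣A∣≡2 = global A (∣p∣≡1+k⇒Nonempty A ∣A∣≡2)

  pairwiseLca⇒joinSemilattice : GlobalPairwiseLcaProperty _⊑_ → IsJoinSemilattice _⊑_
  pairwiseLca⇒joinSemilattice pairwise x y with x ≟ y
  ... | yes refl = x , ⊑-refl , ⊑-refl , λ _ x⊑w _ → x⊑w
  ... | no x≢y = let lca@(v , _) = pairwise (pair x y) (∣pair∣≡2 x≢y)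
                 in v , IsSupremum⇒IsLeastUpperBound (UniqueLCA⇒IsSupremum lca)
    where open WithDecidableOrder (pairwiseLca⇒decidable pairwise)

proposition3p7 : ∀ {ℓ : Level} (n : ℕ) (_⊑_ : Fin n → Fin n → Set ℓ)
    → IsPartialOrder _≡_ _⊑_
    → (GlobalPairwiseLcaProperty _⊑_ ⇔ GlobalLcaProperty _⊑_)
      × (GlobalLcaProperty _⊑_ ⇔ IsJoinSemilattice _⊑_)
proposition3p7 n _⊑_ isPO =
  mk⇔ (joinSemilattice⇒globalLca ∘ pairwiseLca⇒joinSemilattice) globalLca⇒pairwiseLca ,
  mk⇔ (pairwiseLca⇒joinSemilattice ∘ globalLca⇒pairwiseLca) joinSemilattice⇒globalLca
  where open FinitePoset isPO
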